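{- Let $(C,\phi)$ be a multistate monotone system, let $k\in\{1,\ldots,M\}$, and let $\mathfrak{P}_k$ be the set of minimal $k$-level path vectors. Then for all $\bm{y}\in\mathfrak{C}$, $$\phi_k(\bm{y})=\sum_{\bm{x}\in\mathrm{cl}(\mathfrak{P}_k)}\delta_k(\bm{x})\,\mathrm{I}(\bm{y}\ge\bm{x}),$$ where $\delta_k$ is the signed domination function of $\mathrm{cl}(\mathfrak{P}_k)$.
   Context: A multistate monotone system (MMS) $(C,\phi)$ has component set $C=\{1,\ldots,n\}$, component state sets $\mathcal{S}_i=\{0,1,\ldots,m_i\}$, component state space $\mathfrak{C}=\mathcal{S}_1\times\cdots\times\mathcal{S}_n$, system state set $\{0,1,\ldots,M\}$, and a structure function $\phi:\mathfrak{C}\to\{0,\ldots,M\}$ non-decreasing in each argument. The $k$-level structure function is $\phi_k(\bm{x})=\mathrm{I}(\phi(\bm{x})\ge k)$, $\mathrm{I}$ the indicator. Vectors are ordered componentwise ($\bm{y}\le\bm{x}$ iff $y_i\le x_i$ for all $i$; $\bm{y}<\bm{x}$ iff $\bm{y}\le\bm{x}$ and $\bm{y}\ne\bm{x}$). A minimal $k$-level path vector is $\bm{x}\in\mathfrak{C}$ with $\phi(\bm{x})\ge k$ and $\phi(\bm{y})<k$ for all $\bm{y}\in\mathfrak{C}$ with $\bm{y}<\bm{x}$. For a set $\mathfrak{X}$ of pairwise incomparable vectors, $\mathrm{cl}(\mathfrak{X})$ is the smallest set containing $\mathfrak{X}$ closed under componentwise maximum $\vee$. A formation of $\bm{x}\in\mathrm{cl}(\mathfrak{X})$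 is a nonempty subset $\{\bm{x}_{i_1},\ldots,\bm{x}_{i_j}\}\subseteq\mathfrak{X}$ with $\bm{x}=\bm{x}_{i_1}\vee\cdots\vee\bm{x}_{i_j}$, odd or even according to the parity of $j$; the signed domination function is $\delta(\bm{x})=$ (number of odd formations) $-$ (number of even formations). -}

module Defs where

open import Data.Nat as ℕ using (ℕ; _≤_; _<_; _⊔_)
open import Data.Nat.Properties as ℕP using (_≤?_)
open import Data.Integer as ℤ using (ℤ; +_; -_)
open import Data.List using (List; []; _∷_; map; sum; foldr; length; _++_)
open import Data.List.Membership.Propositional using (_∈_)
open import Data.List.Relation.Unary.Unique.Propositional using (Unique)
open import Data.Vec using (Vec; zipWith)
open import Data.Vec.Properties using (≡-dec)
open import Data.Vec.Relation.Binary.Pointwise.Inductive as PW using (Pointwise)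
open import Data.Product using (_×_; ∃)
import Data.Bool
open import Data.Bool using (Bool; true; false; if_then_else_)
open import Relation.Nullary using (¬_; Dec; yes; no; does)
open import Relation.Binary.PropositionalEquality using (_≡_)

_≼_ : {n : ℕ} → Vec ℕ n → Vec ℕ n → Set
_≼_ = Pointwise _≤_

_≺_ : {n : ℕ} → Vec ℕ n → Vec ℕ n → Set
y ≺ x = (y ≼ x) × ¬ (y ≡ x)

_≼?_ : {n : ℕ} → (x y : Vec ℕ n) → Dec (x ≼ y)
x ≼? y = PW.decidable _≤?_ x y

_∨_ : {n : ℕ} → Vec ℕ n → Vec ℕ n → Vec ℕ n
_∨_ = zipWith _⊔_

-- Multistate monotone system with n components, component state sets {0..mᵢ},
-- system state set {0..M}, structure function φ (only its values on the
-- component state space matter).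
record MMS (n : ℕ) : Set where
  field
    m    : Vec ℕ n
    M    : ℕ
    φ    : Vec ℕ n → ℕ
    φ-range : ∀ x → x ≼ m → φ x ≤ M
    φ-mono  : ∀ x y → x ≼ m → y ≼ m → x ≼ y → φ x ≤ φ y

  InSpace : Vec ℕ n → Set
  InSpace x = x ≼ m

  φ[_] : ℕ → Vec ℕ n → ℤ
  φ[ k ] x = if does (k ≤? φ x) then + 1 else + 0

  MinPath : ℕ → Vec ℕ n → Set
  MinPath k x = InSpace x × k ≤ φ x × (∀ y → InSpace y → y ≺ x → φ y < k)

data Cl {n : ℕ} (X : List (Vec ℕ n)) : Vec ℕ n → Set where
  base : ∀ {x} → x ∈ X → Cl X x
  join : ∀ {x y} → Cl X x → Cl X y → Cl X (x ∨ y)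

-- all sub-lists of a list (= all subsets, when the list has no duplicates)
sublists : {A : Set} → List A → List (List A)
sublists []       = [] ∷ []
sublists (x ∷ xs) = let r = sublists xs in r ++ map (x ∷_) r

joinAll : {n : ℕ} → Vec ℕ n → List (Vec ℕ n) → Vec ℕ n
joinAll x xs = foldr _∨_ x xs

isEven : ℕ → Bool
isEven ℕ.zero = true
isEven (ℕ.suc k) = Data.Bool.not (isEven k)

-- signed contribution of a subset S ⊆ 𝔛 to δ(x): +1 if S is an odd
-- formation of x, −1 if S is an even formation of x, 0 otherwise
-- (in particular 0 for the empty subset).
formationSign : {n : ℕ} → Vec ℕ n → List (Vec ℕ n) → ℤ
formationSign x [] = + 0
formationSign x (s ∷ ss) with does (≡-dec ℕ._≟_ (joinAll s ss) x)
... | false = + 0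
... | true  = if isEven (length (s ∷ ss)) then - (+ 1) else + 1

sumℤ : List ℤ → ℤ
sumℤ = foldr ℤ._+_ (+ 0)

-- signed domination function δ of cl(𝔛), where 𝔛 is given as a
-- duplicate-free list: (#odd formations) − (#even formations)
δ : {n : ℕ} → List (Vec ℕ n) → Vec ℕ n → ℤ
δ X x = sumℤ (map (formationSign x) (sublists X))

I≽ : {n : ℕ} → Vec ℕ n → Vec ℕ n → ℤ
I≽ y x = if does (x ≼? y) then + 1 else + 0

-- Descending coordinatewise from a k-level path vector until no coordinate can be lowered
-- reaches a minimal one below it, so φₖ(y) is the indicator that some minimal path vector
-- lies below y.  By inclusion–exclusion that indicator is the sum, over the nonempty sets S
-- of minimal path vectors, of (−1)^(|S|+1) I(y ≥ ⋁S); grouping the sets S by the vector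
-- x = ⋁S ∈ cl(𝔓ₖ) turns the sum into Σₓ δₖ(x) I(y ≥ x).
module Submission where

open import Defs
open import Data.Nat using (ℕ; _≤_)
open import Data.Integer using (ℤ; _*_)
open import Data.List using (List; map)
open import Data.List.Membership.Propositional using (_∈_)
open import Data.List.Relation.Unary.Unique.Propositional using (Unique)
open import Data.Vec using (Vec)
open import Function.Bundles using (_⇔_)
open import Relation.Binary.PropositionalEquality using (_≡_)

open import Data.Bool using (Bool; true; false; _∧_; if_then_else_) renaming (_∨_ to _∨ᵇ_)
open import Data.Empty using (⊥-elim)
open import Data.Fin using (Fin; zero; suc)
import Data.Fin.Properties as Fin
open import Data.Integer using (+_; -_; _+_; _-_)
import Data.Integer.Properties as ℤ
open import Data.Integer.Tactic.RingSolver using (solve-∀)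
open import Data.List using ([]; _∷_; _++_; length)
open import Data.List.Properties using (map-++; map-∘)
open import Data.List.Membership.Propositional using (find; lose)
import Data.List.Membership.Propositional.Properties as ∈
open import Data.List.Relation.Unary.All as All using (All; []; _∷_)
open import Data.List.Relation.Unary.AllPairs using (_∷_)
open import Data.List.Relation.Unary.Any using (Any; here; there; any?)
open import Data.Nat using (suc; _<_; pred; s≤s; z≤n)
open import Data.Nat.Induction using (<-wellFounded)
import Data.Nat.Properties as ℕ
open import Data.Product using (_×_; _,_; ∃)
open import Data.Sum using (inj₁; inj₂)
import Data.Vec as Vec
open import Data.Vec using ([]; _∷_; lookup; updateAt)
open import Data.Vec.Properties using (≡-dec)
import Data.Vec.Relation.Binary.Pointwise.Inductive as Pointwise
open import Data.Vec.Relation.Binary.Pointwise.Inductive using ([]; _∷_)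
open import Function using (_∘_)
open import Function.Bundles using (Equivalence; mk⇔)
open import Induction.WellFounded using (Acc; acc)
open import Relation.Nullary using (¬_; yes; no; does; _×-dec_)
open import Relation.Nullary.Decidable using (does-⇔)
open import Relation.Binary.PropositionalEquality using (refl; sym; trans; cong; cong₂; module ≡-Reasoning)

open ≡-Reasoning

private
  variable
    A B : Set
    n : ℕ

indicator : Bool → ℤ
indicator b = if b then + 1 else + 0

indicator-∧ : ∀ a b → indicator (a ∧ b) ≡ indicator a * indicator b
indicator-∧ true  true  = refl
indicator-∧ true  false = refl
indicator-∧ false true  = refl
indicator-∧ false false = refl

indicator-∨ : ∀ a b → indicator (a ∨ᵇ b) ≡ indicator b + indicator a * (+ 1 - indicator b)
indicator-∨ true  true  = refl
indicator-∨ true  false = refl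
indicator-∨ false true  = refl
indicator-∨ false false = refl

sumℤ-++ : ∀ (as bs : List ℤ) → sumℤ (as ++ bs) ≡ sumℤ as + sumℤ bs
sumℤ-++ []       bs = sym (ℤ.+-identityˡ _)
sumℤ-++ (a ∷ as) bs = trans (cong (_+_ a) (sumℤ-++ as bs)) (sym (ℤ.+-assoc a _ _))

sum-map-cong : ∀ {f g : A → ℤ} (xs : List A) → (∀ {x} → x ∈ xs → f x ≡ g x) →
               sumℤ (map f xs) ≡ sumℤ (map g xs)
sum-map-cong []       f≡g = refl
sum-map-cong (x ∷ xs) f≡g = cong₂ _+_ (f≡g (here refl)) (sum-map-cong xs (f≡g ∘ there))

sum-map-zero : ∀ {f : A → ℤ} (xs : List A) → (∀ {x} → x ∈ xs → f x ≡ + 0) → sumℤ (map f xs) ≡ + 0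
sum-map-zero []       f≡0 = refl
sum-map-zero (x ∷ xs) f≡0 = cong₂ _+_ (f≡0 (here refl)) (sum-map-zero xs (f≡0 ∘ there))

sum-map-+ : ∀ (f g : A → ℤ) xs → sumℤ (map (λ x → f x + g x) xs) ≡ sumℤ (map f xs) + sumℤ (map g xs)
sum-map-+ f g []       = refl
sum-map-+ f g (x ∷ xs) = trans (cong (_+_ (f x + g x)) (sum-map-+ f g xs)) (interchange (f x) (g x) _ _)
  where
  interchange : ∀ a b c d → (a + b) + (c + d) ≡ (a + c) + (b + d)
  interchange = solve-∀

sum-map-- : ∀ (f g : A → ℤ) xs → sumℤ (map (λ x → f x - g x) xs) ≡ sumℤ (map f xs) - sumℤ (map g xs)
sum-map-- f g []       = refl
sum-map-- f g (x ∷ xs) = trans (cong (_+_ (f x - g x)) (sum-map-- f g xs)) (interchange (f x) (g x) _ _)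
  where
  interchange : ∀ a b c d → (a - b) + (c - d) ≡ (a + c) - (b + d)
  interchange = solve-∀

sum-map-*ˡ : ∀ (f : A → ℤ) c xs → sumℤ (map (λ x → c * f x) xs) ≡ c * sumℤ (map f xs)
sum-map-*ˡ f c []       = sym (ℤ.*-zeroʳ c)
sum-map-*ˡ f c (x ∷ xs) = trans (cong (_+_ (c * f x)) (sum-map-*ˡ f c xs)) (sym (ℤ.*-distribˡ-+ c (f x) _))

sum-map-*ʳ : ∀ (f : A → ℤ) c xs → sumℤ (map (λ x → f x * c) xs) ≡ sumℤ (map f xs) * c
sum-map-*ʳ f c []       = sym (ℤ.*-zeroˡ c)
sum-map-*ʳ f c (x ∷ xs) = trans (cong (_+_ (f x * c)) (sum-map-*ʳ f c xs)) (sym (ℤ.*-distribʳ-+ c (f x) _))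

sum-map-supported-at : ∀ (f : A → ℤ) {j} xs → Unique xs → j ∈ xs →
                       (∀ x → ¬ x ≡ j → f x ≡ + 0) → sumℤ (map f xs) ≡ f j
sum-map-supported-at f (x ∷ xs) (x∉xs ∷ _) (here refl) f≡0 = begin
  f x + sumℤ (map f xs) ≡⟨ cong (_+_ (f x)) (sum-map-zero xs λ y∈xs → f≡0 _ (All.lookup x∉xs y∈xs ∘ sym)) ⟩
  f x + + 0             ≡⟨ ℤ.+-identityʳ (f x) ⟩
  f x                   ∎
sum-map-supported-at f (x ∷ xs) (x∉xs ∷ xs!) (there j∈xs) f≡0 = begin
  f x + sumℤ (map f xs) ≡⟨ cong (_+ sumℤ (map f xs)) (f≡0 x (All.lookup x∉xs j∈xs)) ⟩
  + 0 + sumℤ (map f xs) ≡⟨ ℤ.+-identityˡ _ ⟩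
  sumℤ (map f xs)       ≡⟨ sum-map-supported-at f xs xs! j∈xs f≡0 ⟩
  _                     ∎

sum-map-comm : ∀ (g : A → B → ℤ) xs (ys : List B) →
               sumℤ (map (λ x → sumℤ (map (g x) ys)) xs) ≡ sumℤ (map (λ y → sumℤ (map (λ x → g x y) xs)) ys)
sum-map-comm g []       ys = sym (sum-map-zero ys λ _ → refl)
sum-map-comm g (x ∷ xs) ys = trans (cong (_+_ (sumℤ (map (g x) ys))) (sum-map-comm g xs ys))
                                   (sym (sum-map-+ (g x) _ ys))

sum-map-sublists-∷ : ∀ (f : List A → ℤ) x xs →
  sumℤ (map f (sublists (x ∷ xs))) ≡ sumℤ (map f (sublists xs)) + sumℤ (map (f ∘ (x ∷_)) (sublists xs))
sum-map-sublists-∷ f x xs = begin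
  sumℤ (map f (sublists xs ++ map (x ∷_) (sublists xs)))
    ≡⟨ cong sumℤ (map-++ f (sublists xs) _) ⟩
  sumℤ (map f (sublists xs) ++ map f (map (x ∷_) (sublists xs)))
    ≡⟨ sumℤ-++ (map f (sublists xs)) _ ⟩
  sumℤ (map f (sublists xs)) + sumℤ (map f (map (x ∷_) (sublists xs)))
    ≡⟨ cong (λ t → sumℤ (map f (sublists xs)) + sumℤ t) (sym (map-∘ (sublists xs))) ⟩
  sumℤ (map f (sublists xs)) + sumℤ (map (f ∘ (x ∷_)) (sublists xs)) ∎

sublists-⊆ : ∀ (xs : List A) {S} → S ∈ sublists xs → All (_∈ xs) S
sublists-⊆ []       (here refl) = []
sublists-⊆ (x ∷ xs) S∈ with ∈.∈-++⁻ (sublists xs) S∈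
... | inj₁ S∈′ = All.map there (sublists-⊆ xs S∈′)
... | inj₂ xS∈ with ∈.∈-map⁻ (x ∷_) xS∈
... | _ , S∈′ , refl = here refl ∷ All.map there (sublists-⊆ xs S∈′)

≼-refl : {x : Vec ℕ n} → x ≼ x
≼-refl = Pointwise.refl ℕ.≤-refl

≼-trans : {x y z : Vec ℕ n} → x ≼ y → y ≼ z → x ≼ z
≼-trans = Pointwise.trans ℕ.≤-trans

∨-≼⁻ : ∀ {a b y : Vec ℕ n} → (a ∨ b) ≼ y → a ≼ y × b ≼ y
∨-≼⁻ {a = []}     {[]}     []       = [] , []
∨-≼⁻ {a = a ∷ as} {b ∷ bs} (p ∷ ps) =
  let q , r = ∨-≼⁻ {a = as} {bs} ps in ℕ.≤-trans (ℕ.m≤m⊔n a b) p ∷ q , ℕ.≤-trans (ℕ.m≤n⊔m a b) p ∷ r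

∨-lub : ∀ {a b y : Vec ℕ n} → a ≼ y → b ≼ y → (a ∨ b) ≼ y
∨-lub []       []       = []
∨-lub (p ∷ ps) (q ∷ qs) = ℕ.⊔-lub p q ∷ ∨-lub ps qs

joinAll-≼⇔All : ∀ {y : Vec ℕ n} a as → joinAll a as ≼ y ⇔ All (_≼ y) (a ∷ as)
joinAll-≼⇔All a as = mk⇔ (to as) (from as)
  where
  to : ∀ {y} as → joinAll a as ≼ y → All (_≼ y) (a ∷ as)
  to []       a≼y = a≼y ∷ []
  to (b ∷ bs) ⋁≼y with ∨-≼⁻ ⋁≼y
  ... | b≼y , rest≼y with to bs rest≼y
  ... | a≼y ∷ bs≼y = a≼y ∷ b≼y ∷ bs≼y
  from : ∀ {y} as → All (_≼ y) (a ∷ as) → joinAll a as ≼ y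
  from []       (a≼y ∷ [])         = a≼y
  from (b ∷ bs) (a≼y ∷ b≼y ∷ bs≼y) = ∨-lub b≼y (from bs (a≼y ∷ bs≼y))

joinAll-∈-Cl : ∀ {X : List (Vec ℕ n)} {s} ss → s ∈ X → All (_∈ X) ss → Cl X (joinAll s ss)
joinAll-∈-Cl []       s∈X []           = base s∈X
joinAll-∈-Cl (t ∷ ts) s∈X (t∈X ∷ ts∈X) = join (base t∈X) (joinAll-∈-Cl ts s∈X ts∈X)

joinAll-∷-≼⇔ : ∀ {y : Vec ℕ n} x s ss → joinAll x (s ∷ ss) ≼ y ⇔ (x ≼ y × joinAll s ss ≼ y)
joinAll-∷-≼⇔ {y = y} x s ss = mk⇔ to from
  where
  to : joinAll x (s ∷ ss) ≼ y → x ≼ y × joinAll s ss ≼ y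
  to ⋁≼y with Equivalence.to (joinAll-≼⇔All x (s ∷ ss)) ⋁≼y
  ... | x≼y ∷ s≼y ∷ ss≼y = x≼y , Equivalence.from (joinAll-≼⇔All s ss) (s≼y ∷ ss≼y)
  from : x ≼ y × joinAll s ss ≼ y → joinAll x (s ∷ ss) ≼ y
  from (x≼y , rest≼y) with Equivalence.to (joinAll-≼⇔All s ss) rest≼y
  ... | s≼y ∷ ss≼y = Equivalence.from (joinAll-≼⇔All x (s ∷ ss)) (x≼y ∷ s≼y ∷ ss≼y)

I≽-joinAll-∷ : ∀ (y x s : Vec ℕ n) ss → I≽ y (joinAll x (s ∷ ss)) ≡ I≽ y x * I≽ y (joinAll s ss)
I≽-joinAll-∷ y x s ss = begin
  indicator (does (joinAll x (s ∷ ss) ≼? y))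
    ≡⟨ cong indicator (does-⇔ (joinAll-∷-≼⇔ x s ss) (joinAll x (s ∷ ss) ≼? y)
                              (x ≼? y ×-dec joinAll s ss ≼? y)) ⟩
  indicator (does (x ≼? y) ∧ does (joinAll s ss ≼? y))
    ≡⟨ indicator-∧ (does (x ≼? y)) _ ⟩
  I≽ y x * I≽ y (joinAll s ss) ∎

altSign : ℕ → ℤ
altSign l = if isEven l then - (+ 1) else + 1

altSign-suc : ∀ l → altSign (suc l) ≡ - altSign l
altSign-suc l with isEven l
... | true  = refl
... | false = refl

signedJoinIndicator : Vec ℕ n → List (Vec ℕ n) → ℤ
signedJoinIndicator y []       = + 0
signedJoinIndicator y (s ∷ ss) = altSign (length (s ∷ ss)) * I≽ y (joinAll s ss)

emptyIndicator : List A → ℤ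
emptyIndicator []      = + 1
emptyIndicator (_ ∷ _) = + 0

sum-emptyIndicator-sublists : ∀ (xs : List A) → sumℤ (map emptyIndicator (sublists xs)) ≡ + 1
sum-emptyIndicator-sublists []       = refl
sum-emptyIndicator-sublists (x ∷ xs) =
  trans (sum-map-sublists-∷ emptyIndicator x xs)
        (cong₂ _+_ (sum-emptyIndicator-sublists xs) (sum-map-zero (sublists xs) λ _ → refl))

signedJoinIndicator-∷ : ∀ (y x : Vec ℕ n) S →
  signedJoinIndicator y (x ∷ S) ≡ I≽ y x * (emptyIndicator S - signedJoinIndicator y S)
signedJoinIndicator-∷ y x []       = trans (ℤ.*-identityˡ _) (sym (ℤ.*-identityʳ _))
signedJoinIndicator-∷ y x (s ∷ ss) = begin
  altSign (suc (suc (length ss))) * I≽ y (joinAll x (s ∷ ss))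
    ≡⟨ cong₂ _*_ (altSign-suc (suc (length ss))) (I≽-joinAll-∷ y x s ss) ⟩
  - altSign (suc (length ss)) * (I≽ y x * I≽ y (joinAll s ss))
    ≡⟨ rearrange (altSign (suc (length ss))) (I≽ y x) _ ⟩
  I≽ y x * (+ 0 - altSign (suc (length ss)) * I≽ y (joinAll s ss)) ∎
  where
  rearrange : ∀ a b c → - a * (b * c) ≡ b * (+ 0 - a * c)
  rearrange = solve-∀

sum-signedJoinIndicator-sublists : ∀ (y : Vec ℕ n) X →
  sumℤ (map (signedJoinIndicator y) (sublists X)) ≡ indicator (does (any? (_≼? y) X))
sum-signedJoinIndicator-sublists y []       = refl
sum-signedJoinIndicator-sublists {n = n} y (x ∷ xs) = begin
  sumℤ (map T (sublists (x ∷ xs)))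
    ≡⟨ sum-map-sublists-∷ T x xs ⟩
  sumℤ (map T (sublists xs)) + sumℤ (map (T ∘ (x ∷_)) (sublists xs))
    ≡⟨ cong (_+_ (sumℤ (map T (sublists xs)))) new-sets ⟩
  sumℤ (map T (sublists xs)) + I≽ y x * (+ 1 - sumℤ (map T (sublists xs)))
    ≡⟨ cong (λ t → t + I≽ y x * (+ 1 - t)) (sum-signedJoinIndicator-sublists y xs) ⟩
  indicator (does (any? (_≼? y) xs)) + I≽ y x * (+ 1 - indicator (does (any? (_≼? y) xs)))
    ≡⟨ sym (indicator-∨ (does (x ≼? y)) _) ⟩
  indicator (does (any? (_≼? y) (x ∷ xs))) ∎
  where
  T : List (Vec ℕ n) → ℤ
  T = signedJoinIndicator y
  new-sets : sumℤ (map (T ∘ (x ∷_)) (sublists xs)) ≡ I≽ y x * (+ 1 - sumℤ (map T (sublists xs)))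
  new-sets = begin
    sumℤ (map (T ∘ (x ∷_)) (sublists xs))
      ≡⟨ sum-map-cong (sublists xs) (λ {S} _ → signedJoinIndicator-∷ y x S) ⟩
    sumℤ (map (λ S → I≽ y x * (emptyIndicator S - T S)) (sublists xs))
      ≡⟨ sum-map-*ˡ (λ S → emptyIndicator S - T S) (I≽ y x) (sublists xs) ⟩
    I≽ y x * sumℤ (map (λ S → emptyIndicator S - T S) (sublists xs))
      ≡⟨ cong (I≽ y x *_) (sum-map-- emptyIndicator T (sublists xs)) ⟩
    I≽ y x * (sumℤ (map emptyIndicator (sublists xs)) - sumℤ (map T (sublists xs)))
      ≡⟨ cong (λ t → I≽ y x * (t - sumℤ (map T (sublists xs)))) (sum-emptyIndicator-sublists xs) ⟩
    I≽ y x * (+ 1 - sumℤ (map T (sublists xs))) ∎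

formationSign-joinAll : ∀ (s : Vec ℕ n) ss →
                        formationSign (joinAll s ss) (s ∷ ss) ≡ altSign (length (s ∷ ss))
formationSign-joinAll s ss with ≡-dec ℕ._≟_ (joinAll s ss) (joinAll s ss)
... | yes _  = refl
... | no ≢⋁ = ⊥-elim (≢⋁ refl)

formationSign-≢ : ∀ (x s : Vec ℕ n) ss → ¬ x ≡ joinAll s ss → formationSign x (s ∷ ss) ≡ + 0
formationSign-≢ x s ss x≢⋁ with ≡-dec ℕ._≟_ (joinAll s ss) x
... | yes ⋁≡x = ⊥-elim (x≢⋁ (sym ⋁≡x))
... | no _    = refl

sum-δ*I≽ : ∀ (y : Vec ℕ n) X L → Unique L → (∀ {x} → Cl X x → x ∈ L) →
  sumℤ (map (λ x → δ X x * I≽ y x) L) ≡ sumℤ (map (signedJoinIndicator y) (sublists X))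
sum-δ*I≽ y X L L! Cl⊆L = begin
  sumℤ (map (λ x → δ X x * I≽ y x) L)
    ≡⟨ sum-map-cong L (λ {x} _ → sym (sum-map-*ʳ (formationSign x) (I≽ y x) (sublists X))) ⟩
  sumℤ (map (λ x → sumℤ (map (λ S → formationSign x S * I≽ y x) (sublists X))) L)
    ≡⟨ sum-map-comm (λ x S → formationSign x S * I≽ y x) L (sublists X) ⟩
  sumℤ (map (λ S → sumℤ (map (λ x → formationSign x S * I≽ y x) L)) (sublists X))
    ≡⟨ sum-map-cong (sublists X) formations-of ⟩
  sumℤ (map (signedJoinIndicator y) (sublists X)) ∎
  where
  formations-of : ∀ {S} → S ∈ sublists X →
                  sumℤ (map (λ x → formationSign x S * I≽ y x) L) ≡ signedJoinIndicator y S
  formations-of {[]}     _  = sum-map-zero L λ {x} _ → ℤ.*-zeroˡ (I≽ y x)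
  formations-of {s ∷ ss} S∈ with sublists-⊆ X S∈
  ... | s∈X ∷ ss⊆X = begin
    sumℤ (map (λ x → formationSign x (s ∷ ss) * I≽ y x) L)
      ≡⟨ sum-map-supported-at _ L L! (Cl⊆L (joinAll-∈-Cl ss s∈X ss⊆X)) not-⋁ ⟩
    formationSign (joinAll s ss) (s ∷ ss) * I≽ y (joinAll s ss)
      ≡⟨ cong (_* I≽ y (joinAll s ss)) (formationSign-joinAll s ss) ⟩
    signedJoinIndicator y (s ∷ ss) ∎
    where
    not-⋁ : ∀ x → ¬ x ≡ joinAll s ss → formationSign x (s ∷ ss) * I≽ y x ≡ + 0
    not-⋁ x x≢⋁ = trans (cong (_* I≽ y x) (formationSign-≢ x s ss x≢⋁)) (ℤ.*-zeroˡ (I≽ y x))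

decrement : Vec ℕ n → Fin n → Vec ℕ n
decrement x i = updateAt x i pred

decrement-≼ : ∀ (x : Vec ℕ n) i → decrement x i ≼ x
decrement-≼ (a ∷ as) zero    = ℕ.pred[n]≤n ∷ ≼-refl
decrement-≼ (a ∷ as) (suc i) = ℕ.≤-refl ∷ decrement-≼ as i

sum-decrement-< : ∀ (x : Vec ℕ n) i → 0 < lookup x i → Vec.sum (decrement x i) < Vec.sum x
sum-decrement-< (suc a ∷ as) zero    _    = ℕ.n<1+n _
sum-decrement-< (a ∷ as)     (suc i) 0<xᵢ = ℕ.+-monoʳ-< a (sum-decrement-< as i 0<xᵢ)

≺⇒≼-decrement : ∀ {z x : Vec ℕ n} → z ≺ x → ∃ λ i → 0 < lookup x i × z ≼ decrement x i
≺⇒≼-decrement {z = []}     {[]}     (_ , z≢x)        = ⊥-elim (z≢x refl)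
≺⇒≼-decrement {z = a ∷ as} {b ∷ bs} (a≤b ∷ as≼bs , z≢x) with a ℕ.≟ b
... | no a≢b = zero , ℕ.<-≤-trans (s≤s z≤n) a<b , ℕ.pred-mono-≤ a<b ∷ as≼bs
  where
  a<b : a < b
  a<b = ℕ.≤∧≢⇒< a≤b a≢b
... | yes refl with ≺⇒≼-decrement (as≼bs , z≢x ∘ cong (a ∷_))
...   | i , 0<bᵢ , as≼bs′ = suc i , 0<bᵢ , ℕ.≤-refl ∷ as≼bs′

module _ (S : MMS n) (k : ℕ) where
  open MMS S

  -- Once no coordinate of x can be lowered without dropping below level k, x is minimal,
  -- because every z ≺ x lies below some decrement of x.
  minPath-≼ : ∀ x → Acc _<_ (Vec.sum x) → InSpace x → k ≤ φ x → ∃ λ p → MinPath k p × p ≼ x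
  minPath-≼ x (acc rs) x∈𝔖 k≤φx
    with Fin.any? (λ i → 0 ℕ.<? lookup x i ×-dec k ℕ.≤? φ (decrement x i))
  ... | yes (i , 0<xᵢ , k≤φx′)
    with minPath-≼ (decrement x i) (rs (sum-decrement-< x i 0<xᵢ))
                   (≼-trans (decrement-≼ x i) x∈𝔖) k≤φx′
  ...   | p , p-min , p≼x′ = p , p-min , ≼-trans p≼x′ (decrement-≼ x i)
  minPath-≼ x _ x∈𝔖 k≤φx | no unlowerable = x , (x∈𝔖 , k≤φx , minimal) , ≼-refl
    where
    minimal : ∀ z → InSpace z → z ≺ x → φ z < k
    minimal z z∈𝔖 z≺x with ≺⇒≼-decrement z≺x
    ... | i , 0<xᵢ , z≼x′ =
      ℕ.≤-<-trans (φ-mono z (decrement x i) z∈𝔖 (≼-trans (decrement-≼ x i) x∈𝔖) z≼x′)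
                  (ℕ.≰⇒> λ k≤φx′ → unlowerable (i , 0<xᵢ , k≤φx′))

  ≤φ⇔Any-≼ : ∀ P → (∀ x → (x ∈ P) ⇔ MinPath k x) → ∀ y → InSpace y → k ≤ φ y ⇔ Any (_≼ y) P
  ≤φ⇔Any-≼ P P⇔MinPath y y∈𝔖 = mk⇔ to from
    where
    to : k ≤ φ y → Any (_≼ y) P
    to k≤φy with minPath-≼ y (<-wellFounded _) y∈𝔖 k≤φy
    ... | p , p-min , p≼y = lose (Equivalence.from (P⇔MinPath p) p-min) p≼y
    from : Any (_≼ y) P → k ≤ φ y
    from some with find some
    ... | p , p∈P , p≼y with Equivalence.to (P⇔MinPath p) p∈P
    ...   | p∈𝔖 , k≤φp , _ = ℕ.≤-trans k≤φp (φ-mono p y p∈𝔖 y∈𝔖 p≼y)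

theorem3p2 : ∀ {n : ℕ} (S : MMS n) (k : ℕ) → 1 ≤ k → k ≤ MMS.M S →
    (P : List (Vec ℕ n)) → Unique P → (∀ x → (x ∈ P) ⇔ MMS.MinPath S k x) →
    (L : List (Vec ℕ n)) → Unique L → (∀ x → (x ∈ L) ⇔ Cl P x) →
    ∀ y → MMS.InSpace S y →
    MMS.φ[_] S k y ≡ sumℤ (map (λ x → δ P x * I≽ y x) L)
theorem3p2 S k _ _ P _ P⇔MinPath L L! L⇔Cl y y∈𝔖 = begin
  indicator (does (k ℕ.≤? φ y))
    ≡⟨ cong indicator (does-⇔ (≤φ⇔Any-≼ S k P P⇔MinPath y y∈𝔖) (k ℕ.≤? φ y) (any? (_≼? y) P)) ⟩
  indicator (does (any? (_≼? y) P))
    ≡⟨ sum-signedJoinIndicator-sublists y P ⟨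
  sumℤ (map (signedJoinIndicator y) (sublists P))
    ≡⟨ sum-δ*I≽ y P L L! (λ {x} → Equivalence.from (L⇔Cl x)) ⟨
  sumℤ (map (λ x → δ P x * I≽ y x) L) ∎
  where open MMS S
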